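{- Let $\pi\in\mathfrak{S}_n$ be an indecomposable permutation with exactly one descent, written $\pi=\pi^{(1)}\pi^{(2)}$ where $\pi^{(1)}$ and $\pi^{(2)}$ are the increasing orderings of sets $A_1\ni n$ and $A_2\ni 1$ respectively. Let $T$ be a labeled tree on $[n]$. Then $T$ is a spanning tree of $G_\pi$ if and only if $T$ is an intransitive tree with $\mathrm{LocMax}(T)=A_1$ and $\mathrm{LocMin}(T)=A_2$.
   Context: $G_\pi$: permutation graph on $[n]$, $a<b$ adjacent iff $b$ appears before $a$ in $\pi$. For a labeled tree $T$ on $[n]$, a vertex is a local maximum (resp. minimum) if all its neighbours in $T$ have smaller (resp. larger) labels; $\mathrm{LocMax}(T)$, $\mathrm{LocMin}(T)$ denote these sets. $T$ is intransitive if every vertex is a local minimum or a local maximum. -}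

module Defs where

open import Data.Nat using (ℕ; suc; zero)
import Data.Nat as ℕ
open import Data.Fin using (Fin; toℕ; _<_; _≤_)
open import Data.Fin.Permutation using (Permutation′; _⟨$⟩ʳ_; _⟨$⟩ˡ_)
open import Data.List using (List; []; _∷_; _∷ʳ_; length)
open import Data.List.Relation.Unary.Linked using (Linked)
open import Data.List.Relation.Unary.Unique.Propositional using (Unique)
open import Data.Product using (Σ; ∃; _×_)
open import Data.Sum using (_⊎_)
open import Relation.Nullary using (¬_)
open import Relation.Binary.PropositionalEquality using (_≡_)
open import Relation.Binary.Construct.Closure.ReflexiveTransitive using (Star)

-- Vertex set [n] is modelled as Fin n (label i+1 ↔ element i; order preserved).
-- A permutation π is read as the word π(0) π(1) ... π(n-1): position p holds value π ⟨$⟩ʳ p.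

pos : ∀ {n} → Permutation′ n → Fin n → Fin n
pos π v = π ⟨$⟩ˡ v

PermGraph : ∀ {n} → Permutation′ n → Fin n → Fin n → Set
PermGraph π a b =
  (a < b × pos π b < pos π a) ⊎ (b < a × pos π a < pos π b)

IsDescentAt : ∀ {n} → Permutation′ n → Fin n → Set
IsDescentAt π d =
  Σ (Fin _) λ j → (toℕ j ≡ suc (toℕ d)) × ((π ⟨$⟩ʳ j) < (π ⟨$⟩ʳ d))

Indecomposable : ∀ {n} → Permutation′ n → Set
Indecomposable {n} π =
  ¬ (Σ ℕ λ k → (1 ℕ.≤ k) × (k ℕ.< n) ×
       (∀ (i : Fin n) → toℕ i ℕ.< k → toℕ (π ⟨$⟩ʳ i) ℕ.< k))

Connected : ∀ {n} → (Fin n → Fin n → Set) → Set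
Connected {n} E = ∀ (u v : Fin n) → Star E u v

-- A cycle: distinct vertices v, w₁..wₖ, w (k ≥ 1, so at least 3 vertices),
-- consecutive ones adjacent, and w adjacent to v.
HasCycle : ∀ {n} → (Fin n → Fin n → Set) → Set
HasCycle {n} E =
  Σ (Fin n) λ v → Σ (Fin n) λ w → Σ (List (Fin n)) λ ws →
    (1 ℕ.≤ length ws) × Unique ((v ∷ ws) ∷ʳ w) ×
    Linked E ((v ∷ ws) ∷ʳ w) × E w v

record IsTree {n} (E : Fin n → Fin n → Set) : Set where
  field
    sym       : ∀ {u v} → E u v → E v u
    irrefl    : ∀ {u} → ¬ E u u
    connected : Connected E
    acyclic   : ¬ HasCycle E

-- T is a subgraph of G (same vertex set, so a tree T ⊆ G is a spanning tree of G)
_⊆ᴱ_ : ∀ {n} → (Fin n → Fin n → Set) → (Fin n → Fin n → Set) → Set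
_⊆ᴱ_ {n} T G = ∀ (u v : Fin n) → T u v → G u v

LocMax : ∀ {n} → (Fin n → Fin n → Set) → Fin n → Set
LocMax {n} T v = ∀ (u : Fin n) → T v u → u < v

LocMin : ∀ {n} → (Fin n → Fin n → Set) → Fin n → Set
LocMin {n} T v = ∀ (u : Fin n) → T v u → v < u

Intransitive : ∀ {n} → (Fin n → Fin n → Set) → Set
Intransitive {n} T = ∀ (v : Fin n) → LocMin T v ⊎ LocMax T v

-- With its only descent at position d, π increases on positions ≤ d and on positions > d,
-- so in every inversion (b before a, a < b) the value b lies in the first run A₁ and a in
-- the second run A₂: the edges of G_π are exactly the pairs a < b with a ∈ A₂, b ∈ A₁.
-- A tree on n ≥ 2 vertices has no isolated vertex, so if T ⊆ G_π each vertex is a local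
-- maximum or minimum according to its run.  Conversely, if LocMax T = A₁ and LocMin T = A₂,
-- no edge of T stays inside one run, and its larger end is the local maximum, in A₁.

module Submission where

open import Defs
open import Data.Nat using (ℕ)
open import Data.Fin using (Fin; _<_; _≤_)
open import Data.Fin.Permutation using (Permutation′)
open import Data.Product using (_×_)
open import Function.Bundles using (_⇔_)
open import Relation.Binary.PropositionalEquality using (_≡_)

import Data.Nat as ℕ
import Data.Nat.Properties as ℕ
open import Data.Empty using (⊥-elim)
open import Data.Fin using (toℕ; fromℕ<)
open import Data.Fin.Properties using (<-cmp; _≟_; _≤?_; toℕ-fromℕ<; toℕ<n; ≤∧≢⇒<)
open import Data.Fin.Permutation using (_⟨$⟩ʳ_; inverseʳ)
open import Data.Product using (Σ-syntax; ∃; _,_)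
open import Data.Sum using (_⊎_; inj₁; inj₂)
open import Function.Base using (_∘_)
open import Function.Bundles using (mk⇔; Injection; Equivalence)
open import Function.Construct.Composition using (_⇔-∘_)
open import Function.Definitions using (Injective)
open import Function.Properties.Inverse using (↔⇒↣)
open import Relation.Binary using (Tri; tri<; tri≈; tri>)
open import Relation.Binary.Construct.Closure.ReflexiveTransitive using (Star; ε; _◅_)
open import Relation.Binary.PropositionalEquality using (_≢_; refl; sym; trans; cong; subst; subst₂)
open import Relation.Nullary using (¬_; yes; no)

DescentAt : ∀ {n m} → (Fin n → Fin m) → Fin n → Set
DescentAt {n} f i = Σ[ j ∈ Fin n ] (toℕ j ≡ ℕ.suc (toℕ i)) × (f j < f i)

module _ {n m} (f : Fin n → Fin m) (f-injective : Injective _≡_ _≡_ f) where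

  inversion⇒descent : ∀ {p q} → p < q → f q < f p →
                      Σ[ i ∈ Fin n ] p ≤ i × i < q × DescentAt f i
  inversion⇒descent {q = q} = go (toℕ q) refl
    where
    go : ∀ k {p q} → toℕ q ≡ k → p < q → f q < f p →
         Σ[ i ∈ Fin n ] p ≤ i × i < q × DescentAt f i
    go ℕ.zero    q≡0 p<q _ = ⊥-elim (ℕ.n≮0 (subst (_ ℕ.<_) q≡0 p<q))
    go (ℕ.suc k) {p} {q} q≡1+k p<q fq<fp = compare (<-cmp (f q) (f q′))
      where
      k<n : k ℕ.< n
      k<n = ℕ.<⇒≤ (subst (ℕ._< n) q≡1+k (toℕ<n q))
      q′ : Fin n
      q′ = fromℕ< k<n
      q≡1+q′ : toℕ q ≡ ℕ.suc (toℕ q′)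
      q≡1+q′ = trans q≡1+k (cong ℕ.suc (sym (toℕ-fromℕ< k<n)))
      q′<q : q′ < q
      q′<q = subst (toℕ q′ ℕ.<_) (sym q≡1+q′) (ℕ.n<1+n (toℕ q′))
      p≤q′ : p ≤ q′
      p≤q′ = ℕ.≤-pred (subst (toℕ p ℕ.<_) q≡1+q′ p<q)

      compare : Tri (f q < f q′) (f q ≡ f q′) (f q′ < f q) →
                Σ[ i ∈ Fin n ] p ≤ i × i < q × DescentAt f i
      compare (tri< fq<fq′ _ _) = q′ , p≤q′ , q′<q , q , q≡1+q′ , fq<fq′
      compare (tri≈ _ fq≡fq′ _) =
        ⊥-elim (ℕ.1+n≢n (trans (sym q≡1+q′) (cong toℕ (f-injective fq≡fq′))))
      compare (tri> _ _ fq′<fq) =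
        let i , p≤i , i<q′ , descent = go k (toℕ-fromℕ< k<n) p<q′ fq′<fp
        in  i , p≤i , ℕ.<-trans i<q′ q′<q , descent
        where
        fq′<fp : f q′ < f p
        fq′<fp = ℕ.<-trans fq′<fq fq<fp
        p<q′ : p < q′
        p<q′ = ≤∧≢⇒< p≤q′ λ { refl → ℕ.<-irrefl refl fq′<fp }

inversion-straddles-descent : ∀ {n} (π : Permutation′ n) {d : Fin n} →
  (∀ d′ → IsDescentAt π d′ → d′ ≡ d) →
  ∀ {p q} → p < q → π ⟨$⟩ʳ q < π ⟨$⟩ʳ p → p ≤ d × d < q
inversion-straddles-descent π descent-unique p<q inv
  with i , p≤i , i<q , descent ← inversion⇒descent (π ⟨$⟩ʳ_) (Injection.injective (↔⇒↣ π)) p<q inv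
  rewrite descent-unique i descent = p≤i , i<q

CrossGraph : ∀ {n} → (High Low : Fin n → Set) → Fin n → Fin n → Set
CrossGraph High Low a b = (a < b × Low a × High b) ⊎ (b < a × High a × Low b)

permGraph⇔crossGraph : ∀ {n} (π : Permutation′ n) {d : Fin n} →
  (∀ d′ → IsDescentAt π d′ → d′ ≡ d) →
  ∀ a b → PermGraph π a b ⇔ CrossGraph (λ v → pos π v ≤ d) (λ v → d < pos π v) a b
permGraph⇔crossGraph π {d} descent-unique a b = mk⇔ to from
  where
  value-inversion-straddles : ∀ {a b} → a < b → pos π b < pos π a → pos π b ≤ d × d < pos π a
  value-inversion-straddles a<b pb<pa = inversion-straddles-descent π descent-unique pb<pa
    (subst₂ _<_ (sym (inverseʳ π)) (sym (inverseʳ π)) a<b)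

  to : PermGraph π a b → CrossGraph (λ v → pos π v ≤ d) (λ v → d < pos π v) a b
  to (inj₁ (a<b , pb<pa)) = let pb≤d , d<pa = value-inversion-straddles a<b pb<pa
                            in  inj₁ (a<b , d<pa , pb≤d)
  to (inj₂ (b<a , pa<pb)) = let pa≤d , d<pb = value-inversion-straddles b<a pa<pb
                            in  inj₂ (b<a , pa≤d , d<pb)

  from : CrossGraph (λ v → pos π v ≤ d) (λ v → d < pos π v) a b → PermGraph π a b
  from (inj₁ (a<b , d<pa , pb≤d)) = inj₁ (a<b , ℕ.≤-<-trans pb≤d d<pa)
  from (inj₂ (b<a , pa≤d , d<pb)) = inj₂ (b<a , ℕ.≤-<-trans pa≤d d<pb)

module _ {n} {T : Fin n → Fin n → Set}
         (T-sym : ∀ {u v} → T u v → T v u) (neighbour : ∀ v → ∃ (T v))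
         {High Low : Fin n → Set}
         (partition : ∀ v → High v ⊎ Low v) (disjoint : ∀ {v} → High v → ¬ Low v) where

  locMax⇔high : T ⊆ᴱ CrossGraph High Low → ∀ v → LocMax T v ⇔ High v
  locMax⇔high T⊆ v = mk⇔ locMax⇒high high⇒locMax
    where
    locMax⇒high : LocMax T v → High v
    locMax⇒high max with neighbour v
    ... | u , vu with T⊆ v u vu
    ... | inj₁ (v<u , _)      = ⊥-elim (ℕ.<-asym v<u (max u vu))
    ... | inj₂ (_ , high , _) = high

    high⇒locMax : High v → LocMax T v
    high⇒locMax high u vu with T⊆ v u vu
    ... | inj₁ (_ , low , _) = ⊥-elim (disjoint high low)
    ... | inj₂ (u<v , _)     = u<v

  locMin⇔low : T ⊆ᴱ CrossGraph High Low → ∀ v → LocMin T v ⇔ Low v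
  locMin⇔low T⊆ v = mk⇔ locMin⇒low low⇒locMin
    where
    locMin⇒low : LocMin T v → Low v
    locMin⇒low min with neighbour v
    ... | u , vu with T⊆ v u vu
    ... | inj₁ (_ , low , _) = low
    ... | inj₂ (u<v , _)     = ⊥-elim (ℕ.<-asym u<v (min u vu))

    low⇒locMin : Low v → LocMin T v
    low⇒locMin low u vu with T⊆ v u vu
    ... | inj₁ (v<u , _)      = v<u
    ... | inj₂ (_ , high , _) = ⊥-elim (disjoint high low)

  ⊆-crossGraph : (∀ {v} → High v → LocMax T v) → (∀ {v} → Low v → LocMin T v) →
                 T ⊆ᴱ CrossGraph High Low
  ⊆-crossGraph high⇒locMax low⇒locMin u v uv with partition u | partition v
  ... | inj₁ hu | inj₁ hv = ⊥-elim (ℕ.<-asym (high⇒locMax hu v uv) (high⇒locMax hv u (T-sym uv)))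
  ... | inj₁ hu | inj₂ lv = inj₂ (high⇒locMax hu v uv , hu , lv)
  ... | inj₂ lu | inj₁ hv = inj₁ (low⇒locMin lu v uv , lu , hv)
  ... | inj₂ lu | inj₂ lv = ⊥-elim (ℕ.<-asym (low⇒locMin lu v uv) (low⇒locMin lv u (T-sym uv)))

  ⊆-crossGraph⇔ : (T ⊆ᴱ CrossGraph High Low) ⇔
                  (Intransitive T × (∀ v → LocMax T v ⇔ High v) × (∀ v → LocMin T v ⇔ Low v))
  ⊆-crossGraph⇔ = mk⇔ characterise
    λ (_ , max⇔high , min⇔low) →
      ⊆-crossGraph (Equivalence.from (max⇔high _)) (Equivalence.from (min⇔low _))
    where
    characterise : T ⊆ᴱ CrossGraph High Low →
                   Intransitive T × (∀ v → LocMax T v ⇔ High v) × (∀ v → LocMin T v ⇔ Low v)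
    characterise T⊆ = intransitive , locMax⇔high T⊆ , locMin⇔low T⊆
      where
      intransitive : Intransitive T
      intransitive v with partition v
      ... | inj₁ high = inj₂ (Equivalence.from (locMax⇔high T⊆ v) high)
      ... | inj₂ low  = inj₁ (Equivalence.from (locMin⇔low T⊆ v) low)

star-≢⇒step : ∀ {n} {E : Fin n → Fin n → Set} {u w} → Star E u w → u ≢ w → ∃ (E u)
star-≢⇒step ε        u≢u = ⊥-elim (u≢u refl)
star-≢⇒step (uw ◅ _) _   = _ , uw

connected⇒neighbour : ∀ {n} {E : Fin n → Fin n → Set} → Connected E →
                      ∀ {x y} → x ≢ y → ∀ v → ∃ (E v)
connected⇒neighbour connected {x} {y} x≢y v with v ≟ x
... | yes refl = star-≢⇒step (connected v y) x≢y
... | no v≢x   = star-≢⇒step (connected v x) v≢x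

⊆ᴱ-cong : ∀ {n} {T G H : Fin n → Fin n → Set} →
          (∀ u v → G u v ⇔ H u v) → (T ⊆ᴱ G) ⇔ (T ⊆ᴱ H)
⊆ᴱ-cong G⇔H = mk⇔ (λ T⊆G u v → Equivalence.to   (G⇔H u v) ∘ T⊆G u v)
                  (λ T⊆H u v → Equivalence.from (G⇔H u v) ∘ T⊆H u v)

proposition5p5 : (n : ℕ) (π : Permutation′ n) (d : Fin n) →
    IsDescentAt π d →
    (∀ (d′ : Fin n) → IsDescentAt π d′ → d′ ≡ d) →
    Indecomposable π →
    (T : Fin n → Fin n → Set) → IsTree T →
    ((T ⊆ᴱ PermGraph π) ⇔
      (Intransitive T ×
       (∀ (v : Fin n) → LocMax T v ⇔ (pos π v ≤ d)) ×
       (∀ (v : Fin n) → LocMin T v ⇔ (d < pos π v))))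
proposition5p5 n π d (j , j≡1+d , _) descent-unique _ T tree =
  ⊆-crossGraph⇔ T-sym (connected⇒neighbour connected d≢j) partition disjoint
    ⇔-∘ ⊆ᴱ-cong (permGraph⇔crossGraph π descent-unique)
  where
  open IsTree tree renaming (sym to T-sym)

  d≢j : d ≢ j
  d≢j d≡j = ℕ.1+n≢n (trans (sym j≡1+d) (cong toℕ (sym d≡j)))

  partition : ∀ v → pos π v ≤ d ⊎ d < pos π v
  partition v with pos π v ≤? d
  ... | yes pv≤d = inj₁ pv≤d
  ... | no  pv≰d = inj₂ (ℕ.≰⇒> pv≰d)

  disjoint : ∀ {v} → pos π v ≤ d → ¬ d < pos π v
  disjoint = ℕ.≤⇒≯
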